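{- Let $b, r, k$ be positive integers with $\gcd(b-1,r)=1$, and let $c$ be any integer. Then there exists a non-negative integer $n<b^r k$ such that $s_b(kn)\equiv c \pmod r$.
   Context: For an integer $b\ge2$ and a non-negative integer $m$, $s_b(m)$ denotes the sum of the digits of $m$ in base $b$. -}

module Defs where

open import Data.Nat using (ℕ; zero; suc; _+_; NonZero)
open import Data.Nat.DivMod using (_/_; _%_)

-- Digit sum with fuel: each step strips the least significant base-b digit.
-- With fuel f ≥ n all digits of n are consumed (n / b < n for n > 0, b ≥ 2),
-- and further steps contribute 0 % b = 0.
digitSumAux : (b : ℕ) → .{{NonZero b}} → ℕ → ℕ → ℕ
digitSumAux b zero    n = 0
digitSumAux b (suc f) n = n % b + digitSumAux b f (n / b)

-- s_b(m): sum of the digits of m in base b (meaningful for b ≥ 2).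
digitSum : (b : ℕ) → .{{NonZero b}} → ℕ → ℕ
digitSum b m = digitSumAux b m m

module Submission where

open import Defs
open import Data.Nat
  using (ℕ; zero; suc; _+_; _*_; _^_; _<_; _≤_; _∸_; _≤?_; z≤n; s≤s; z<s; NonZero; >-nonZero; >-nonZero⁻¹)
open import Data.Nat.Properties
open import Data.Nat.DivMod
  using (_/_; _%_; m≡m%n+[m/n]*n; m%n<n; [m+kn]%n≡m%n; m<n⇒m%n≡m; +-distrib-/-∣ʳ; m<n⇒m/n≡0; m*n/n≡m; m/n<m;
         m<n*o⇒m/o<n; 0/n≡0)
open import Data.Nat.Divisibility using (n∣m*n)
open import Data.Nat.GCD using (gcd; module Bézout)
open import Data.Nat.Coprimality using (coprime-Bézout; gcd≡1⇒coprime)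
open import Data.Nat.Tactic.RingSolver using (solve; solve-∀)
open import Algebra.Properties.CommutativeSemigroup +-commutativeSemigroup using (interchange; x∙yz≈y∙xz)
import Data.Integer as ℤ
open ℤ using (ℤ; +_; -_; 1ℤ; _-_)
open import Data.Integer.Properties using (pos-+; pos-*; neg-distribˡ-*)
open import Data.Integer.DivMod using (_%ℕ_; _/ℕ_; n%ℕd<d; a≡a%ℕn+[a/ℕn]*n)
open import Data.Integer.Divisibility using (_∣_)
import Data.Integer.Divisibility.Signed as Signed
open Signed using (divides; ∣-refl; ∣n⇒∣m*n; ∣m∣n⇒∣m-n; ∣⇒∣ᵤ)
import Data.Integer.Tactic.RingSolver as ℤ-Solver
open import Data.Product using (Σ; _×_; _,_; ∃-syntax)
open import Data.List using ([]; _∷_)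
open import Relation.Nullary using (yes; no)
open import Relation.Binary.PropositionalEquality using (_≡_; refl; sym; trans; cong; cong₂; subst; subst₂; module ≡-Reasoning)

-- For k ≤ bʲ write k(bʲ − 1) = (k − 1)·bʲ + (bʲ − k). The two summands occupy disjoint digit
-- positions, and the base-b digits of k − 1 and bʲ − k = (bʲ − 1) − (k − 1) pair up to b − 1
-- (no carries), so s_b(k(bʲ − 1)) = j(b − 1). Choose t with k ≤ bᵗ ≤ bk. Since b − 1 is
-- invertible modulo r, some d < r satisfies (t + d)(b − 1) ≡ c (mod r), and n = b^(t+d) − 1
-- is below b^(t+d) ≤ bk·b^(r−1) = bʳk.

module DigitSum {b : ℕ} .{{_ : NonZero b}} (1<b : 1 < b) where
  open ≡-Reasoning

  0%b≡0 : 0 % b ≡ 0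
  0%b≡0 = m<n⇒m%n≡m (>-nonZero⁻¹ b)

  digitSumAux-zero : ∀ f → digitSumAux b f 0 ≡ 0
  digitSumAux-zero zero    = refl
  digitSumAux-zero (suc f) =
    cong₂ _+_ 0%b≡0 (trans (cong (digitSumAux b f) (0/n≡0 b)) (digitSumAux-zero f))

  digitSumAux-fuel : ∀ {f g} n → n ≤ f → n ≤ g → digitSumAux b f n ≡ digitSumAux b g n
  digitSumAux-fuel {f} {g} zero _ _ = trans (digitSumAux-zero f) (sym (digitSumAux-zero g))
  digitSumAux-fuel {suc f} {suc g} n@(suc _) n≤1+f n≤1+g =
    cong (_+_ (n % b)) (digitSumAux-fuel {f} {g} (n / b) (<⇒≤pred (<-≤-trans n/b<n n≤1+f))
                                                         (<⇒≤pred (<-≤-trans n/b<n n≤1+g)))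
    where
    n/b<n : n / b < n
    n/b<n = m/n<m n b 1<b

  digitSum-step : ∀ m → digitSum b m ≡ m % b + digitSum b (m / b)
  digitSum-step zero      = sym (cong₂ _+_ 0%b≡0 (cong (digitSum b) (0/n≡0 b)))
  digitSum-step m@(suc _) =
    cong (_+_ (m % b)) (digitSumAux-fuel (m / b) (<⇒≤pred (m/n<m m b 1<b)) ≤-refl)

  digitSum-digit+ : ∀ {d} q → d < b → digitSum b (d + q * b) ≡ d + digitSum b q
  digitSum-digit+ {d} q d<b = begin
    digitSum b (d + q * b)                          ≡⟨ digitSum-step (d + q * b) ⟩
    (d + q * b) % b + digitSum b ((d + q * b) / b)  ≡⟨ cong₂ (λ x y → x + digitSum b y) mod-eq div-eq ⟩
    d + digitSum b q                                ∎
    where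
    mod-eq : (d + q * b) % b ≡ d
    mod-eq = trans ([m+kn]%n≡m%n d q b) (m<n⇒m%n≡m d<b)
    div-eq : (d + q * b) / b ≡ q
    div-eq = trans (+-distrib-/-∣ʳ d (n∣m*n q)) (cong₂ _+_ (m<n⇒m/n≡0 d<b) (m*n/n≡m q b))

  split-lowest-digit : ∀ j {a} → a < b ^ suc j →
    ∃[ a₀ ] ∃[ a₁ ] a₀ < b × a₁ < b ^ j × a₀ + a₁ * b ≡ a
  split-lowest-digit j {a} a<bʲ⁺¹ =
    a % b , a / b , m%n<n a b , m<n*o⇒m/o<n (subst (a <_) (*-comm b (b ^ j)) a<bʲ⁺¹) ,
    sym (m≡m%n+[m/n]*n a b)

  digitSum-shift : ∀ j x {y} → y < b ^ j → digitSum b (x * b ^ j + y) ≡ digitSum b x + digitSum b y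
  digitSum-shift zero x (s≤s z≤n) =
    trans (cong (digitSum b) (trans (+-identityʳ _) (*-identityʳ x))) (sym (+-identityʳ _))
  digitSum-shift (suc j) x y<bʲ⁺¹ with split-lowest-digit j y<bʲ⁺¹
  ... | y₀ , y₁ , y₀<b , y₁<bʲ , refl = begin
    digitSum b (x * b ^ suc j + (y₀ + y₁ * b))       ≡⟨ cong (digitSum b) (rearrange x b (b ^ j) y₀ y₁) ⟩
    digitSum b (y₀ + (x * b ^ j + y₁) * b)           ≡⟨ digitSum-digit+ (x * b ^ j + y₁) y₀<b ⟩
    y₀ + digitSum b (x * b ^ j + y₁)                 ≡⟨ cong (_+_ y₀) (digitSum-shift j x y₁<bʲ) ⟩
    y₀ + (digitSum b x + digitSum b y₁)              ≡⟨ x∙yz≈y∙xz y₀ (digitSum b x) (digitSum b y₁) ⟩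
    digitSum b x + (y₀ + digitSum b y₁)              ≡⟨ cong (_+_ (digitSum b x)) (digitSum-digit+ y₁ y₀<b) ⟨
    digitSum b x + digitSum b (y₀ + y₁ * b)          ∎
    where
    rearrange : ∀ x b p d q → x * (b * p) + (d + q * b) ≡ d + (x * p + q) * b
    rearrange = solve-∀

  digitSum-complement : ∀ j {a c} → suc (a + c) ≡ b ^ j → digitSum b a + digitSum b c ≡ j * (b ∸ 1)
  digitSum-complement zero {zero}  {zero}  _  = refl
  digitSum-complement zero {zero}  {suc _} ()
  digitSum-complement zero {suc _}         ()
  digitSum-complement (suc j) {a} {c} a+c+1≡bʲ⁺¹
    with split-lowest-digit j (≤-trans (s≤s (m≤m+n a c)) (≤-reflexive a+c+1≡bʲ⁺¹))
  ... | a₀ , a₁ , a₀<b , a₁<bʲ , refl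
    with m≤n⇒∃[o]m+o≡n a₀<b | m≤n⇒∃[o]m+o≡n a₁<bʲ
  ... | c₀ , a₀+c₀+1≡b | c₁ , a₁+c₁+1≡bʲ = begin
    digitSum b (a₀ + a₁ * b) + digitSum b c
      ≡⟨ cong₂ _+_ (digitSum-digit+ a₁ a₀<b) (trans (cong (digitSum b) c-digits) (digitSum-digit+ c₁ c₀<b)) ⟩
    (a₀ + digitSum b a₁) + (c₀ + digitSum b c₁)
      ≡⟨ interchange a₀ (digitSum b a₁) c₀ (digitSum b c₁) ⟩
    (a₀ + c₀) + (digitSum b a₁ + digitSum b c₁)
      ≡⟨ cong₂ _+_ (cong (_∸ 1) a₀+c₀+1≡b) (digitSum-complement j {a₁} {c₁} a₁+c₁+1≡bʲ) ⟩
    (b ∸ 1) + j * (b ∸ 1)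
      ∎
    where
    c₀<b : c₀ < b
    c₀<b = subst (c₀ <_) a₀+c₀+1≡b (s≤s (m≤n+m c₀ a₀))
    complement-digits : ∀ {B P} a₀ c₀ a₁ c₁ → suc a₀ + c₀ ≡ B → suc a₁ + c₁ ≡ P →
      B * P ≡ suc (a₀ + a₁ * B) + (c₀ + c₁ * B)
    complement-digits a₀ c₀ a₁ c₁ refl refl = solve (a₀ ∷ c₀ ∷ a₁ ∷ c₁ ∷ [])
    c-digits : c ≡ c₀ + c₁ * b
    c-digits = +-cancelˡ-≡ (suc (a₀ + a₁ * b)) c (c₀ + c₁ * b)
      (trans a+c+1≡bʲ⁺¹ (complement-digits a₀ c₀ a₁ c₁ a₀+c₀+1≡b a₁+c₁+1≡bʲ))

  digitSum-*-pred-pow : ∀ j {k} → 1 ≤ k → k ≤ b ^ j → digitSum b (k * (b ^ j ∸ 1)) ≡ j * (b ∸ 1)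
  digitSum-*-pred-pow j {suc k} _ k+1≤bʲ with m≤n⇒∃[o]m+o≡n k+1≤bʲ
  ... | c , k+c+1≡bʲ = begin
    digitSum b (suc k * (b ^ j ∸ 1))  ≡⟨ cong (λ p → digitSum b (suc k * (p ∸ 1))) k+c+1≡bʲ ⟨
    digitSum b (suc k * (k + c))      ≡⟨ cong (digitSum b) expand ⟩
    digitSum b (k * (suc k + c) + c)  ≡⟨ cong (λ p → digitSum b (k * p + c)) k+c+1≡bʲ ⟩
    digitSum b (k * b ^ j + c)        ≡⟨ digitSum-shift j k c<bʲ ⟩
    digitSum b k + digitSum b c       ≡⟨ digitSum-complement j {k} {c} k+c+1≡bʲ ⟩
    j * (b ∸ 1)                       ∎
    where
    c<bʲ : c < b ^ j
    c<bʲ = subst (c <_) k+c+1≡bʲ (s≤s (m≤n+m c k))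
    expand : suc k * (k + c) ≡ k * (suc k + c) + c
    expand = solve (k ∷ c ∷ [])

module Powers {b : ℕ} .{{_ : NonZero b}} where
  open ≤-Reasoning

  pow-between : 1 < b → ∀ {k} → 1 ≤ k → ∃[ t ] k ≤ b ^ t × b ^ t ≤ b * k
  pow-between 1<b {suc zero} _ = 0 , ≤-refl , subst (1 ≤_) (sym (*-identityʳ b)) (<⇒≤ 1<b)
  pow-between 1<b {suc (suc k)} _ with pow-between 1<b {suc k} (s≤s z≤n)
  ... | t , k+1≤bᵗ , bᵗ≤b[k+1] with suc (suc k) ≤? b ^ t
  ... | yes k+2≤bᵗ = t , k+2≤bᵗ , ≤-trans bᵗ≤b[k+1] (*-monoʳ-≤ b (n≤1+n _))
  ... | no  k+2≰bᵗ = suc t , k+2≤bᵗ⁺¹ , *-monoʳ-≤ b (m≤n⇒m≤1+n (≤-reflexive bᵗ≡k+1))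
    where
    instance
      bᵗ≢0 : NonZero (b ^ t)
      bᵗ≢0 = m^n≢0 b t
    bᵗ≡k+1 : b ^ t ≡ suc k
    bᵗ≡k+1 = ≤-antisym (≤-pred (≰⇒> k+2≰bᵗ)) k+1≤bᵗ
    k+2≤bᵗ⁺¹ : suc (suc k) ≤ b ^ suc t
    k+2≤bᵗ⁺¹ = subst₂ (λ m n → suc m ≤ n) bᵗ≡k+1 (*-comm (b ^ t) b) (m<m*n (b ^ t) b 1<b)

  pred-pow-bound : ∀ {k} t {d r} → b ^ t ≤ b * k → d < r → b ^ (t + d) ∸ 1 < b ^ r * k
  pred-pow-bound {k} t {d} {r} bᵗ≤bk d<r = begin-strict
    b ^ (t + d) ∸ 1     <⟨ ∸-monoʳ-< z<s (m^n>0 b (t + d)) ⟩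
    b ^ (t + d)         ≡⟨ ^-distribˡ-+-* b t d ⟩
    b ^ t * b ^ d       ≤⟨ *-monoˡ-≤ (b ^ d) bᵗ≤bk ⟩
    b * k * b ^ d       ≡⟨ rearrange b k (b ^ d) ⟩
    b * b ^ d * k       ≤⟨ *-monoˡ-≤ k (^-monoʳ-≤ b d<r) ⟩
    b ^ r * k           ∎
    where
    rearrange : ∀ b k p → b * k * p ≡ b * p * k
    rearrange = solve-∀

module Residues where
  open ≡-Reasoning

  pos-1+* : ∀ p q s t → 1 + p * q ≡ s * t → 1ℤ ℤ.+ + p ℤ.* + q ≡ + s ℤ.* + t
  pos-1+* p q s t eq = begin
    1ℤ ℤ.+ + p ℤ.* + q   ≡⟨ cong (ℤ._+_ 1ℤ) (pos-* p q) ⟨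
    1ℤ ℤ.+ + (p * q)     ≡⟨ pos-+ 1 (p * q) ⟨
    + (1 + p * q)        ≡⟨ cong +_ eq ⟩
    + (s * t)            ≡⟨ pos-* s t ⟩
    + s ℤ.* + t          ∎

  coprime⇒inverse : ∀ m r → gcd m r ≡ 1 → ∃[ u ] + r Signed.∣ u ℤ.* + m - 1ℤ
  coprime⇒inverse m r gcd[m,r]≡1 with coprime-Bézout (gcd≡1⇒coprime gcd[m,r]≡1)
  ... | Bézout.+- x y 1+yr≡xm = + x , divides (+ y) (begin
    + x ℤ.* + m - 1ℤ          ≡⟨ cong (_- 1ℤ) (pos-1+* y r x m 1+yr≡xm) ⟨
    1ℤ ℤ.+ + y ℤ.* + r - 1ℤ   ≡⟨ 1+a-1≡a (+ y ℤ.* + r) ⟩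
    + y ℤ.* + r               ∎)
    where
    1+a-1≡a : ∀ a → 1ℤ ℤ.+ a - 1ℤ ≡ a
    1+a-1≡a = ℤ-Solver.solve-∀
  ... | Bézout.-+ x y 1+xm≡yr = - + x , divides (- + y) (begin
    - + x ℤ.* + m - 1ℤ        ≡⟨ -a*b-1≡-[1+a*b] (+ x) (+ m) ⟩
    - (1ℤ ℤ.+ + x ℤ.* + m)    ≡⟨ cong -_ (pos-1+* x m y r 1+xm≡yr) ⟩
    - (+ y ℤ.* + r)           ≡⟨ neg-distribˡ-* (+ y) (+ r) ⟩
    - + y ℤ.* + r             ∎)
    where
    -a*b-1≡-[1+a*b] : ∀ a b → - a ℤ.* b - 1ℤ ≡ - (1ℤ ℤ.+ a ℤ.* b)
    -a*b-1≡-[1+a*b] = ℤ-Solver.solve-∀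

  residue-solvable : ∀ m r .{{_ : NonZero r}} → gcd m r ≡ 1 → ∀ c t →
    ∃[ d ] d < r × + r ∣ + ((t + d) * m) - c
  residue-solvable m r gcd[m,r]≡1 c t with coprime⇒inverse m r gcd[m,r]≡1
  ... | u , r∣um-1 = d , n%ℕd<d a r , r∣[t+d]m-c
    where
    a : ℤ
    a = u ℤ.* c - + t
    d : ℕ
    d = a %ℕ r
    q : ℤ
    q = a /ℕ r
    e : ℤ
    e = c ℤ.* (u ℤ.* + m - 1ℤ)
    expand : ∀ u c t d m → (t ℤ.+ d) ℤ.* m - c ≡ c ℤ.* (u ℤ.* m - 1ℤ) - ((u ℤ.* c - t) - d) ℤ.* m
    expand = ℤ-Solver.solve-∀
    collapse : ∀ e d q m r → e - ((d ℤ.+ q ℤ.* r) - d) ℤ.* m ≡ e - q ℤ.* m ℤ.* r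
    collapse = ℤ-Solver.solve-∀
    [t+d]m-c≡e-qmr : + ((t + d) * m) - c ≡ e - q ℤ.* + m ℤ.* + r
    [t+d]m-c≡e-qmr = begin
      + ((t + d) * m) - c                    ≡⟨ cong (_- c) (trans (pos-* (t + d) m) (cong (ℤ._* + m) (pos-+ t d))) ⟩
      (+ t ℤ.+ + d) ℤ.* + m - c              ≡⟨ expand u c (+ t) (+ d) (+ m) ⟩
      e - (a - + d) ℤ.* + m                  ≡⟨ cong (λ x → e - (x - + d) ℤ.* + m) (a≡a%ℕn+[a/ℕn]*n a r) ⟩
      e - (+ d ℤ.+ q ℤ.* + r - + d) ℤ.* + m  ≡⟨ collapse e (+ d) q (+ m) (+ r) ⟩
      e - q ℤ.* + m ℤ.* + r                  ∎
    r∣[t+d]m-c : + r ∣ + ((t + d) * m) - c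
    r∣[t+d]m-c = ∣⇒∣ᵤ (subst (+ r Signed.∣_) (sym [t+d]m-c≡e-qmr)
      (∣m∣n⇒∣m-n (∣n⇒∣m*n c r∣um-1) (∣n⇒∣m*n (q ℤ.* + m) ∣-refl)))

open DigitSum
open Powers
open Residues

proposition1 : (b r k : ℕ) → .{{_ : NonZero b}} → 2 ≤ b → 1 ≤ r → 1 ≤ k →
    gcd (b ∸ 1) r ≡ 1 → (c : ℤ) →
    Σ ℕ (λ n → (n < b ^ r * k) × ((+ r) ∣ ((+ digitSum b (k * n)) - c)))
proposition1 b r k 1<b 1≤r 1≤k gcd[b-1,r]≡1 c with pow-between 1<b 1≤k
... | t , k≤bᵗ , bᵗ≤bk = conclude (residue-solvable (b ∸ 1) r {{>-nonZero 1≤r}} gcd[b-1,r]≡1 c t)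
  where
  conclude : ∃[ d ] d < r × + r ∣ + ((t + d) * (b ∸ 1)) - c →
    Σ ℕ (λ n → (n < b ^ r * k) × ((+ r) ∣ ((+ digitSum b (k * n)) - c)))
  conclude (d , d<r , r∣[t+d][b-1]-c) =
    b ^ (t + d) ∸ 1 , pred-pow-bound t bᵗ≤bk d<r ,
    subst (λ s → + r ∣ + s - c) (sym digitSum≡[t+d][b-1]) r∣[t+d][b-1]-c
    where
    digitSum≡[t+d][b-1] : digitSum b (k * (b ^ (t + d) ∸ 1)) ≡ (t + d) * (b ∸ 1)
    digitSum≡[t+d][b-1] = digitSum-*-pred-pow 1<b (t + d) 1≤k (≤-trans k≤bᵗ (^-monoʳ-≤ b (m≤m+n t d)))
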